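{- Let $F\in\mathcal{F}_n$. If $F\notin\mathcal{F}_n^{<5}$ then $\mathcal{R}_F(123,321)=\emptyset$. If $F\in\mathcal{F}_n^{<5}$, then $\delta_{321}$ restricts to a bijection between $\mathcal{R}_F(123,321)$ and $\mathcal{E}^2_F$.
   Context: A Dyck path of semilength $n$ is a lattice path from $(0,n)$ to $(n,0)$ with unit east and south steps never going strictly below $y=n-x$; its height sequence has $h_0=0$, $h_{i+1}=h_i+1$ for east steps and $h_i-1$ for south steps; its height is $\max_i h_i$. $\mathcal{F}_n$ is the set of Ferrers boards whose border $D_F$ is such a path, with border vertices $V_0=(0,n),\dots,V_{2n}=(n,0)$; $\mathcal{F}_n^{<5}$ consists of those whose border has height $<5$. A full rook placement $R$ on $F$ has exactly one square in each row and column of $F$; $\Gamma(V)$ for $V=(a,b)$ is the set of unit squares in $[0,a]\times[0,b]$; a set of squares with at most one per row and column determines a permutation by standardization. $R$ avoids $\tau$ if for every border vertex $V$ the permutation determined by $R\cap\Gamma(V)$ avoids $\tau$; $\mathcal{R}_F(123,321)$ is the set of full rook placements on $F$ avoiding both $123$ and $321$. $\delta_{321}$ is the map on $321$-avoiding full rook placements on $F$ given by $R\mapsto(D_{R,F},D_F)$, where $D_{R,F}$ is the Dyck path with height sequence $j_i=2\ell_i-h_i$, $h_i$ the border height sequence of $F$ and $\ell_i$ the length of the longest increasing subsequence of the permutation determined by $R\cap\Gamma(V_i)$; it is a bijection onto the set of pairs $(D_0,D_F)$ with $D_0$ a Dyck path never strictly above $D_F$. For $F\in\mathcal{F}_n^{<5}$,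 $\mathcal{E}^2_F$ is the set of pairs $(D_0,D_F)$ with $D_0$ a Dyck path of semilength $n$ never strictly above $D_F$, whose height sequence $j_i$ satisfies: $j_i=1$ if $h_i\in\{1,3\}$; $j_i=0$ if $h_i\in\{0,4\}$; $j_i\in\{0,2\}$ if $h_i=2$. -}

module Defs where

open import Data.Nat as ℕ using (ℕ; zero; suc; _∸_; _<?_)
import Data.Nat.Properties as ℕP
open import Data.Integer as ℤ using (ℤ; +_; _⊔_)
open import Data.List using (List; []; _∷_; length; map; filter; zip; upTo; zipWith; take; foldr)
open import Data.List.Relation.Binary.Pointwise using (Pointwise)
open import Data.List.Relation.Binary.Sublist.Propositional using (_⊆_)
open import Data.List.Relation.Unary.All using (All)
open import Data.List.Relation.Unary.Unique.Propositional using (Unique)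
open import Data.List.Membership.Propositional using (_∈_)
open import Data.Maybe using (Maybe; just; nothing)
import Data.Maybe as Maybe
open import Data.Product using (_×_; _,_; proj₁; proj₂; ∃)
open import Data.Sum using (_⊎_)
open import Relation.Binary.PropositionalEquality using (_≡_)
open import Relation.Nullary using (¬_; yes; no)
open import Relation.Nullary.Decidable using (_×-dec_)

-- Lattice paths: E = unit east step, S = unit south step.

data Step : Set where
  E S : Step

Path : Set
Path = List Step

countE : Path → ℕ
countE []      = 0
countE (E ∷ p) = suc (countE p)
countE (S ∷ p) = countE p

countS : Path → ℕ
countS []      = 0
countS (E ∷ p) = countS p
countS (S ∷ p) = suc (countS p)

heightsFrom : ℤ → Path → List ℤ
heightsFrom h []      = h ∷ []
heightsFrom h (E ∷ p) = h ∷ heightsFrom (h ℤ.+ + 1) p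
heightsFrom h (S ∷ p) = h ∷ heightsFrom (h ℤ.- + 1) p

heights : Path → List ℤ
heights = heightsFrom (+ 0)

height : Path → ℤ
height p = foldr _⊔_ (+ 0) (heights p)

-- Dyck path of semilength n: from (0,n) to (n,0) (n east and n south
-- steps) never strictly below y = n - x (all heights ≥ 0).
IsDyck : ℕ → Path → Set
IsDyck n p = countE p ≡ n × countS p ≡ n × All (λ h → + 0 ℤ.≤ h) (heights p)

verticesFrom : ℕ → ℕ → Path → List (ℕ × ℕ)
verticesFrom x y []      = (x , y) ∷ []
verticesFrom x y (E ∷ p) = (x , y) ∷ verticesFrom (suc x) y p
verticesFrom x y (S ∷ p) = (x , y) ∷ verticesFrom x (y ∸ 1) p

vertices : ℕ → Path → List (ℕ × ℕ)
vertices n = verticesFrom 0 n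

-- Ferrers board with border F: column c (0-based) consists of the unit
-- squares [c,c+1]×[r,r+1] with r < colHeight c, where colHeight c is the
-- y-coordinate of the east step of the border from x = c to x = c+1.

colHeightsFrom : ℕ → Path → List ℕ
colHeightsFrom y []      = []
colHeightsFrom y (E ∷ p) = y ∷ colHeightsFrom y p
colHeightsFrom y (S ∷ p) = colHeightsFrom (y ∸ 1) p

colHeights : ℕ → Path → List ℕ
colHeights n = colHeightsFrom n

-- A rook placement with one rook per column is a list R whose c-th entry
-- is the row of the rook in column c.
IsFullRook : ℕ → Path → List ℕ → Set
IsFullRook n F R =
  Pointwise ℕ._<_ R (colHeights n F)
  × Unique R
  × (∀ r → r ℕ.< n → r ∈ R)

rooks : List ℕ → List (ℕ × ℕ)
rooks R = zip (upTo (length R)) R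

-- R ∩ Γ(V) for V = (a,b), read column by column: the sequence of rows.
-- (Its standardization is the permutation determined by R ∩ Γ(V).)
wordAt : List ℕ → ℕ × ℕ → List ℕ
wordAt R (a , b) =
  map proj₂ (filter (λ s → (proj₁ s <? a) ×-dec (proj₂ s <? b)) (rooks R))

-- pattern containment (invariant under standardization)
Contains123 : List ℕ → Set
Contains123 w = ∃ λ x → ∃ λ y → ∃ λ z →
  (x ∷ y ∷ z ∷ []) ⊆ w × x ℕ.< y × y ℕ.< z

Contains321 : List ℕ → Set
Contains321 w = ∃ λ x → ∃ λ y → ∃ λ z →
  (x ∷ y ∷ z ∷ []) ⊆ w × x ℕ.> y × y ℕ.> z

Avoids123 : ℕ → Path → List ℕ → Set
Avoids123 n F R = All (λ V → ¬ Contains123 (wordAt R V)) (vertices n F)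

Avoids321 : ℕ → Path → List ℕ → Set
Avoids321 n F R = All (λ V → ¬ Contains321 (wordAt R V)) (vertices n F)

InR123-321 : ℕ → Path → List ℕ → Set
InR123-321 n F R = IsFullRook n F R × Avoids123 n F R × Avoids321 n F R

-- longest (strictly) increasing subsequence;
-- lisGe b w = longest increasing subsequence of w with all entries ≥ b.

lisGe : ℕ → List ℕ → ℕ
lisGe b []       = 0
lisGe b (x ∷ xs) with b ℕ.≤? x
... | yes _ = suc (lisGe (suc x) xs) ℕ.⊔ lisGe b xs
... | no  _ = lisGe b xs

lis : List ℕ → ℕ
lis = lisGe 0

jseq : ℕ → Path → List ℕ → List ℤ
jseq n F R =
  zipWith (λ V h → (+ 2) ℤ.* (+ lis (wordAt R V)) ℤ.- h) (vertices n F) (heights F)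

stepsFrom : ℤ → List ℤ → Maybe Path
stepsFrom x []       = just []
stepsFrom x (y ∷ ys) with y ℤ.≟ x ℤ.+ + 1 | x ℤ.≟ y ℤ.+ + 1
... | yes _ | _     = Maybe.map (E ∷_) (stepsFrom y ys)
... | no _  | yes _ = Maybe.map (S ∷_) (stepsFrom y ys)
... | no _  | no _  = nothing

pathWithHeights : List ℤ → Maybe Path
pathWithHeights []       = nothing
pathWithHeights (x ∷ xs) with x ℤ.≟ + 0
... | yes _ = stepsFrom x xs
... | no  _ = nothing

δ321 : ℕ → Path → List ℕ → Maybe (Path × Path)
δ321 n F R = Maybe.map (λ D₀ → (D₀ , F)) (pathWithHeights (jseq n F R))

E2cond : ℤ → ℤ → Set
E2cond h j =
    (h ≡ + 1 ⊎ h ≡ + 3 → j ≡ + 1)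
  × (h ≡ + 0 ⊎ h ≡ + 4 → j ≡ + 0)
  × (h ≡ + 2 → j ≡ + 0 ⊎ j ≡ + 2)

NeverAbove : Path → Path → Set
NeverAbove D₀ D = Pointwise ℤ._≤_ (heights D₀) (heights D)

InE2 : ℕ → Path → Path × Path → Set
InE2 n F (D₀ , D) =
  D ≡ F × IsDyck n D₀ × NeverAbove D₀ F
  × Pointwise E2cond (heights F) (heights D₀)

-- At every border vertex V the word R ∩ Γ(V) of a placement avoiding 123 and 321
-- avoids both patterns, so by Erdős–Szekeres it has at most four letters and its
-- standardization is one of twelve shapes, of size the height h of V.  Walking along
-- the border, an east step appends a letter and a south step deletes the largest one,
-- so the shapes form a walk in a small graph whose vertices carry the label 2ℓ − h.
-- Reading off the labels gives a Dyck path satisfying the E² conditions, and forces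
-- h < 5.  Conversely the only freedom in the walk is the choice between the two
-- children of a shape, and siblings differ in their own label or in the label after
-- the next south step; so the labels determine the walk, and a walk chosen to fit
-- given E² labels is realised by words read backwards, i.e. by a placement.

module Submission where

module Placements where

  open import Defs
  open import Data.Empty using (⊥; ⊥-elim)
  open import Data.Integer as ℤ using (ℤ; +_; +≤+; +<+)
  import Data.Integer.Properties as ℤP
  open import Algebra.Properties.AbelianGroup ℤP.+-0-abelianGroup using (∙-cancelˡ)
  open import Data.List
    using (List; []; _∷_; [_]; _++_; length; filter; take; drop; map; zip; zipWith; applyUpTo; foldr)
  open import Data.List.Membership.Propositional using (_∈_; _∉_)
  open import Data.List.Membership.Propositional.Properties using (∈-++⁺ˡ; ∈-++⁺ʳ; ∈-++⁻)
  open import Data.List.Properties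
    using (filter-accept; filter-reject; filter-all; filter-++; ++-assoc; length-++; ∷ʳ-injective; zipWith-map; map-id)
  open import Data.List.Relation.Binary.Permutation.Propositional
    using (_↭_; ↭-refl; ↭-sym; ↭-trans; ↭-prep; ↭-swap; ↭⇒↭ₛ)
  open import Data.List.Relation.Binary.Permutation.Propositional.Properties
    using (All-resp-↭; ∈-resp-↭; shift; ++⁺ʳ)
  import Data.List.Relation.Binary.Permutation.Setoid.Properties as Permutationₛ
  open import Data.List.Relation.Binary.Pointwise using (Pointwise; []; _∷_)
  import Data.List.Relation.Binary.Pointwise as Pointwise
  open import Data.List.Relation.Binary.Sublist.Propositional using (_⊆_; []; _∷_; _∷ʳ_; ⊆-trans; minimum)
  open import Data.List.Relation.Binary.Sublist.Propositional.Properties using (length-mono-≤)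
  open import Data.List.Relation.Unary.All using (All; []; _∷_)
  import Data.List.Relation.Unary.All as All
  import Data.List.Relation.Unary.All.Properties as All
  open import Data.List.Relation.Unary.AllPairs using ([]; _∷_)
  open import Data.List.Relation.Unary.Any using (here; there)
  open import Data.List.Relation.Unary.Unique.Propositional using (Unique)
  open import Data.List.Relation.Unary.Unique.Propositional.Properties using (Unique[x∷xs]⇒x∉xs)
  open import Data.Maybe using (just)
  import Data.Maybe as Maybe
  open import Data.Maybe.Properties using (just-injective)
  open import Data.Nat using (ℕ; zero; suc; _+_; _∸_; _<_; _≤_; z≤n; s≤s; _<?_; _≤?_)
  import Data.Nat.Properties as ℕP
  open import Data.Product using (∃; _×_; _,_; proj₁; proj₂)
  open import Data.Sum using (_⊎_; inj₁; inj₂)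
  open import Data.Unit using (⊤; tt)
  open import Function using (_∘_)
  open import Relation.Binary.Definitions using (tri<; tri≈; tri>)
  open import Relation.Binary.PropositionalEquality
    using (_≡_; _≢_; refl; sym; trans; cong; cong₂; subst; module ≡-Reasoning)
  open import Relation.Binary.PropositionalEquality.Properties using (setoid)
  open import Relation.Nullary using (¬_; Dec; yes; no)
  open import Relation.Nullary.Decidable using (_×-dec_)

  private variable
    k b m r : ℕ
    x y z u : ℕ
    w w′ xs ys Rs : List ℕ
    p : Path
    js : List ℤ

  -- Permutations avoiding 123 and 321

  -- π231 stands for the permutation 2 3 1; by Erdős–Szekeres none has length 5.
  -- HasShape s w: the word w is order-isomorphic to s.
  data Shape : ℕ → Set where
    ε : Shape 0
    π1 : Shape 1
    π12 π21 : Shape 2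
    π132 π231 π213 π312 : Shape 3
    π2143 π2413 π3142 π3412 : Shape 4

  HasShape : Shape k → List ℕ → Set
  HasShape ε     []                    = ⊤
  HasShape π1    (x ∷ [])              = ⊤
  HasShape π12   (x ∷ y ∷ [])          = x < y
  HasShape π21   (x ∷ y ∷ [])          = y < x
  HasShape π132  (x ∷ y ∷ z ∷ [])      = x < z × z < y
  HasShape π231  (x ∷ y ∷ z ∷ [])      = z < x × x < y
  HasShape π213  (x ∷ y ∷ z ∷ [])      = y < x × x < z
  HasShape π312  (x ∷ y ∷ z ∷ [])      = y < z × z < x
  HasShape π2143 (x ∷ y ∷ z ∷ u ∷ [])  = y < x × x < u × u < z
  HasShape π2413 (x ∷ y ∷ z ∷ u ∷ [])  = z < x × x < u × u < y
  HasShape π3142 (x ∷ y ∷ z ∷ u ∷ [])  = y < u × u < x × x < z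
  HasShape π3412 (x ∷ y ∷ z ∷ u ∷ [])  = z < u × u < x × x < y
  HasShape _     _                     = ⊥

  data AppendLast : Shape k → Shape (suc k) → Set where
    to1 : AppendLast ε π1
    to12 : AppendLast π1 π12
    to21 : AppendLast π1 π21
    to231 : AppendLast π12 π231
    to132 : AppendLast π12 π132
    to312 : AppendLast π21 π312
    to213 : AppendLast π21 π213
    to2413 : AppendLast π231 π2413
    to3412 : AppendLast π231 π3412
    to2143 : AppendLast π213 π2143
    to3142 : AppendLast π213 π3142

  deleteMax : Shape (suc k) → Shape k
  deleteMax π1    = ε
  deleteMax π12   = π1
  deleteMax π21   = π1
  deleteMax π132  = π12
  deleteMax π231  = π21
  deleteMax π213  = π21
  deleteMax π312  = π12
  deleteMax π2143 = π213
  deleteMax π2413 = π213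
  deleteMax π3142 = π312
  deleteMax π3412 = π312

  maxPosition : Shape (suc k) → ℕ
  maxPosition π1    = 0
  maxPosition π12   = 1
  maxPosition π21   = 0
  maxPosition π132  = 1
  maxPosition π231  = 1
  maxPosition π213  = 2
  maxPosition π312  = 0
  maxPosition π2143 = 2
  maxPosition π2413 = 1
  maxPosition π3142 = 2
  maxPosition π3412 = 1

  lisShape : Shape k → ℕ
  lisShape ε   = 0
  lisShape π1  = 1
  lisShape π21 = 1
  lisShape _   = 2

  jShape : Shape k → ℕ
  jShape ε     = 0
  jShape π1    = 1
  jShape π12   = 2
  jShape π21   = 0
  jShape π132  = 1
  jShape π231  = 1
  jShape π213  = 1
  jShape π312  = 1
  jShape π2143 = 0
  jShape π2413 = 0
  jShape π3142 = 0
  jShape π3412 = 0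

  jOf : Shape k → ℤ
  jOf s = + jShape s

  jShape-def : (s : Shape k) → + 2 ℤ.* + lisShape s ℤ.- + k ≡ jOf s
  jShape-def ε     = refl
  jShape-def π1    = refl
  jShape-def π12   = refl
  jShape-def π21   = refl
  jShape-def π132  = refl
  jShape-def π231  = refl
  jShape-def π213  = refl
  jShape-def π312  = refl
  jShape-def π2143 = refl
  jShape-def π2413 = refl
  jShape-def π3142 = refl
  jShape-def π3412 = refl

  data Zigzag (x y z : ℕ) : Set where
    peak   : x < y → z < y → Zigzag x y z
    valley : y < x → y < z → Zigzag x y z

  AllZigzag : List ℕ → Set
  AllZigzag w = ∀ {x y z} → (x ∷ y ∷ z ∷ []) ⊆ w → Zigzag x y z

  Avoids : List ℕ → Set
  Avoids w = ¬ Contains123 w × ¬ Contains321 w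

  allZigzag⇒avoids : AllZigzag w → Avoids w
  allZigzag⇒avoids zigzag =
      (λ { (_ , _ , _ , sub , x<y , y<z) → no123 (zigzag sub) x<y y<z })
    , (λ { (_ , _ , _ , sub , y<x , z<y) → no321 (zigzag sub) y<x z<y })
    where
    no123 : Zigzag x y z → x < y → y < z → ⊥
    no123 (peak _ z<y)   _   y<z = ℕP.<-asym y<z z<y
    no123 (valley y<x _) x<y _   = ℕP.<-asym x<y y<x
    no321 : Zigzag x y z → y < x → z < y → ⊥
    no321 (peak x<y _)   y<x _   = ℕP.<-asym x<y y<x
    no321 (valley _ y<z) _   z<y = ℕP.<-asym y<z z<y

  short⇒allZigzag : length w < 3 → AllZigzag w
  short⇒allZigzag short sub = ⊥-elim (ℕP.<⇒≱ short (length-mono-≤ sub))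

  allZigzag₃ : Zigzag x y z → AllZigzag (x ∷ y ∷ z ∷ [])
  allZigzag₃ xyz (refl ∷ refl ∷ refl ∷ []) = xyz
  allZigzag₃ _   (_ ∷ʳ sub)               = short⇒allZigzag ℕP.≤-refl sub
  allZigzag₃ _   (refl ∷ _ ∷ʳ sub)        = short⇒allZigzag ℕP.≤-refl (refl ∷ sub)
  allZigzag₃ _   (refl ∷ refl ∷ _ ∷ʳ ())

  allZigzag₄ : Zigzag x y z → Zigzag x y u → Zigzag x z u → Zigzag y z u →
               AllZigzag (x ∷ y ∷ z ∷ u ∷ [])
  allZigzag₄ _   _   _   yzu (_ ∷ʳ sub)                      = allZigzag₃ yzu sub
  allZigzag₄ _   _   xzu _   (refl ∷ _ ∷ʳ refl ∷ refl ∷ [])  = xzu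
  allZigzag₄ _   xyu _   _   (refl ∷ refl ∷ _ ∷ʳ refl ∷ [])  = xyu
  allZigzag₄ xyz _   _   _   (refl ∷ refl ∷ refl ∷ _)        = xyz
  allZigzag₄ _   _   _   _   (refl ∷ _ ∷ʳ _ ∷ʳ sub)          = short⇒allZigzag ℕP.≤-refl (refl ∷ sub)
  allZigzag₄ _   _   _   _   (refl ∷ _ ∷ʳ refl ∷ _ ∷ʳ ())
  allZigzag₄ _   _   _   _   (refl ∷ refl ∷ _ ∷ʳ _ ∷ʳ ())

  shape⇒allZigzag : (s : Shape k) → HasShape s w → AllZigzag w
  shape⇒allZigzag {w = []}             ε    _ = short⇒allZigzag (s≤s z≤n)
  shape⇒allZigzag {w = _ ∷ []}         π1   _ = short⇒allZigzag (s≤s (s≤s z≤n))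
  shape⇒allZigzag {w = _ ∷ _ ∷ []}     π12  _ = short⇒allZigzag ℕP.≤-refl
  shape⇒allZigzag {w = _ ∷ _ ∷ []}     π21  _ = short⇒allZigzag ℕP.≤-refl
  shape⇒allZigzag {w = _ ∷ _ ∷ _ ∷ []} π132 (x<z , z<y) = allZigzag₃ (peak (ℕP.<-trans x<z z<y) z<y)
  shape⇒allZigzag {w = _ ∷ _ ∷ _ ∷ []} π231 (z<x , x<y) = allZigzag₃ (peak x<y (ℕP.<-trans z<x x<y))
  shape⇒allZigzag {w = _ ∷ _ ∷ _ ∷ []} π213 (y<x , x<z) = allZigzag₃ (valley y<x (ℕP.<-trans y<x x<z))
  shape⇒allZigzag {w = _ ∷ _ ∷ _ ∷ []} π312 (y<z , z<x) = allZigzag₃ (valley (ℕP.<-trans y<z z<x) y<z)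
  shape⇒allZigzag {w = _ ∷ _ ∷ _ ∷ _ ∷ []} π2143 (y<x , x<u , u<z) =
    allZigzag₄ (valley y<x y<z) (valley y<x y<u) (peak x<z u<z) (peak y<z u<z)
    where y<u = ℕP.<-trans y<x x<u; x<z = ℕP.<-trans x<u u<z; y<z = ℕP.<-trans y<u u<z
  shape⇒allZigzag {w = _ ∷ _ ∷ _ ∷ _ ∷ []} π2413 (z<x , x<u , u<y) =
    allZigzag₄ (peak x<y z<y) (peak x<y u<y) (valley z<x z<u) (valley z<y z<u)
    where x<y = ℕP.<-trans x<u u<y; z<u = ℕP.<-trans z<x x<u; z<y = ℕP.<-trans z<u u<y
  shape⇒allZigzag {w = _ ∷ _ ∷ _ ∷ _ ∷ []} π3142 (y<u , u<x , x<z) =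
    allZigzag₄ (valley y<x y<z) (valley y<x y<u) (peak x<z u<z) (peak y<z u<z)
    where y<x = ℕP.<-trans y<u u<x; u<z = ℕP.<-trans u<x x<z; y<z = ℕP.<-trans y<x x<z
  shape⇒allZigzag {w = _ ∷ _ ∷ _ ∷ _ ∷ []} π3412 (z<u , u<x , x<y) =
    allZigzag₄ (peak x<y z<y) (peak x<y u<y) (valley z<x z<u) (valley z<y z<u)
    where u<y = ℕP.<-trans u<x x<y; z<x = ℕP.<-trans z<u u<x; z<y = ℕP.<-trans z<x x<y

  shape⇒avoids : (s : Shape k) → HasShape s w → Avoids w
  shape⇒avoids s shape = allZigzag⇒avoids (shape⇒allZigzag s shape)

  no-123 : Avoids w → (x ∷ y ∷ z ∷ []) ⊆ w → x < y → y < z → ⊥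
  no-123 avoids sub x<y y<z = proj₁ avoids (_ , _ , _ , sub , x<y , y<z)

  no-321 : Avoids w → (x ∷ y ∷ z ∷ []) ⊆ w → y < x → z < y → ⊥
  no-321 avoids sub y<x z<y = proj₂ avoids (_ , _ , _ , sub , y<x , z<y)

  below-or-above : r ≢ x → r < x ⊎ x < r
  below-or-above {r} {x} r≢x with ℕP.<-cmp r x
  ... | tri< r<x _ _ = inj₁ r<x
  ... | tri≈ _ r≡x _ = ⊥-elim (r≢x r≡x)
  ... | tri> _ _ x<r = inj₂ x<r

  no-fifth-letter : (s : Shape 4) (w : List ℕ) → HasShape s w → r ∉ w → ¬ Avoids (w ++ [ r ])
  no-fifth-letter π2143 (x ∷ y ∷ z ∷ u ∷ []) (y<x , x<u , u<z) r∉ av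
    with below-or-above (r∉ ∘ there ∘ there ∘ there ∘ here)
  ... | inj₁ r<u = no-321 av (_ ∷ʳ _ ∷ʳ refl ∷ refl ∷ refl ∷ []) u<z r<u
  ... | inj₂ u<r = no-123 av (_ ∷ʳ refl ∷ _ ∷ʳ refl ∷ refl ∷ []) (ℕP.<-trans y<x x<u) u<r
  no-fifth-letter π2413 (x ∷ y ∷ z ∷ u ∷ []) (z<x , x<u , u<y) r∉ av
    with below-or-above (r∉ ∘ there ∘ there ∘ there ∘ here)
  ... | inj₁ r<u = no-321 av (_ ∷ʳ refl ∷ _ ∷ʳ refl ∷ refl ∷ []) u<y r<u
  ... | inj₂ u<r = no-123 av (refl ∷ _ ∷ʳ _ ∷ʳ refl ∷ refl ∷ []) x<u u<r
  no-fifth-letter π3142 (x ∷ y ∷ z ∷ u ∷ []) (y<u , u<x , x<z) r∉ av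
    with below-or-above (r∉ ∘ there ∘ there ∘ there ∘ here)
  ... | inj₁ r<u = no-321 av (refl ∷ _ ∷ʳ _ ∷ʳ refl ∷ refl ∷ []) u<x r<u
  ... | inj₂ u<r = no-123 av (_ ∷ʳ refl ∷ _ ∷ʳ refl ∷ refl ∷ []) y<u u<r
  no-fifth-letter π3412 (x ∷ y ∷ z ∷ u ∷ []) (z<u , u<x , x<y) r∉ av
    with below-or-above (r∉ ∘ there ∘ there ∘ there ∘ here)
  ... | inj₁ r<u = no-321 av (refl ∷ _ ∷ʳ _ ∷ʳ refl ∷ refl ∷ []) u<x r<u
  ... | inj₂ u<r = no-123 av (_ ∷ʳ _ ∷ʳ refl ∷ refl ∷ refl ∷ []) z<u u<r

  -- The new entry r falls into a gap of w; in all gaps but those listed it completes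
  -- a 123 or a 321.
  appendLast-shape : (s : Shape k) (w : List ℕ) → HasShape s w → r ∉ w → Avoids (w ++ [ r ]) →
                     ∃ λ t → AppendLast s t × HasShape t (w ++ [ r ])
  appendLast-shape ε [] _ _ _ = π1 , to1 , tt
  appendLast-shape π1 (x ∷ []) _ r∉ _ with below-or-above (r∉ ∘ here)
  ... | inj₁ r<x = π21 , to21 , r<x
  ... | inj₂ x<r = π12 , to12 , x<r
  appendLast-shape π12 (x ∷ y ∷ []) x<y r∉ av with below-or-above (r∉ ∘ here)
  ... | inj₁ r<x = π231 , to231 , r<x , x<y
  ... | inj₂ x<r with below-or-above (r∉ ∘ there ∘ here)
  ...   | inj₁ r<y = π132 , to132 , x<r , r<y
  ...   | inj₂ y<r = ⊥-elim (no-123 av (refl ∷ refl ∷ refl ∷ []) x<y y<r)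
  appendLast-shape π21 (x ∷ y ∷ []) y<x r∉ av with below-or-above (r∉ ∘ there ∘ here)
  ... | inj₁ r<y = ⊥-elim (no-321 av (refl ∷ refl ∷ refl ∷ []) y<x r<y)
  ... | inj₂ y<r with below-or-above (r∉ ∘ here)
  ...   | inj₁ r<x = π312 , to312 , y<r , r<x
  ...   | inj₂ x<r = π213 , to213 , y<x , x<r
  appendLast-shape π132 (x ∷ y ∷ z ∷ []) (x<z , z<y) r∉ av
    with below-or-above (r∉ ∘ there ∘ there ∘ here)
  ... | inj₁ r<z = ⊥-elim (no-321 av (_ ∷ʳ refl ∷ refl ∷ refl ∷ []) z<y r<z)
  ... | inj₂ z<r = ⊥-elim (no-123 av (refl ∷ _ ∷ʳ refl ∷ refl ∷ []) x<z z<r)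
  appendLast-shape π231 (x ∷ y ∷ z ∷ []) (z<x , x<y) r∉ av
    with below-or-above (r∉ ∘ there ∘ there ∘ here)
  ... | inj₁ r<z = ⊥-elim (no-321 av (refl ∷ _ ∷ʳ refl ∷ refl ∷ []) z<x r<z)
  ... | inj₂ z<r with below-or-above (r∉ ∘ here)
  ...   | inj₁ r<x = π3412 , to3412 , z<r , r<x , x<y
  ...   | inj₂ x<r with below-or-above (r∉ ∘ there ∘ here)
  ...     | inj₁ r<y = π2413 , to2413 , z<x , x<r , r<y
  ...     | inj₂ y<r = ⊥-elim (no-123 av (refl ∷ refl ∷ _ ∷ʳ refl ∷ []) x<y y<r)
  appendLast-shape π213 (x ∷ y ∷ z ∷ []) (y<x , x<z) r∉ av
    with below-or-above (r∉ ∘ there ∘ here)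
  ... | inj₁ r<y = ⊥-elim (no-321 av (refl ∷ refl ∷ _ ∷ʳ refl ∷ []) y<x r<y)
  ... | inj₂ y<r with below-or-above (r∉ ∘ here)
  ...   | inj₁ r<x = π3142 , to3142 , y<r , r<x , x<z
  ...   | inj₂ x<r with below-or-above (r∉ ∘ there ∘ there ∘ here)
  ...     | inj₁ r<z = π2143 , to2143 , y<x , x<r , r<z
  ...     | inj₂ z<r = ⊥-elim (no-123 av (refl ∷ _ ∷ʳ refl ∷ refl ∷ []) x<z z<r)
  appendLast-shape π312 (x ∷ y ∷ z ∷ []) (y<z , z<x) r∉ av
    with below-or-above (r∉ ∘ there ∘ there ∘ here)
  ... | inj₁ r<z = ⊥-elim (no-321 av (refl ∷ _ ∷ʳ refl ∷ refl ∷ []) z<x r<z)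
  ... | inj₂ z<r = ⊥-elim (no-123 av (_ ∷ʳ refl ∷ refl ∷ refl ∷ []) y<z z<r)
  appendLast-shape π2143 w shape r∉ av = ⊥-elim (no-fifth-letter π2143 w shape r∉ av)
  appendLast-shape π2413 w shape r∉ av = ⊥-elim (no-fifth-letter π2413 w shape r∉ av)
  appendLast-shape π3142 w shape r∉ av = ⊥-elim (no-fifth-letter π3142 w shape r∉ av)
  appendLast-shape π3412 w shape r∉ av = ⊥-elim (no-fifth-letter π3412 w shape r∉ av)

  -- Longest increasing subsequences

  IncreasingFrom : ℕ → List ℕ → Set
  IncreasingFrom b []       = ⊤
  IncreasingFrom b (x ∷ xs) = b ≤ x × IncreasingFrom (suc x) xs

  lisGe-∷ : ∀ b y w → lisGe b w ≤ lisGe b (y ∷ w)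
  lisGe-∷ b y w with b ≤? y
  ... | yes _ = ℕP.m≤n⊔m _ _
  ... | no  _ = ℕP.≤-refl

  increasing⇒≤lisGe : ∀ {b xs w} → xs ⊆ w → IncreasingFrom b xs → length xs ≤ lisGe b w
  increasing⇒≤lisGe []                 _           = z≤n
  increasing⇒≤lisGe {b} (y ∷ʳ sub)     inc         =
    ℕP.≤-trans (increasing⇒≤lisGe sub inc) (lisGe-∷ b y _)
  increasing⇒≤lisGe {b} {x ∷ _} {_ ∷ w} (refl ∷ sub) (b≤x , inc) with b ≤? x
  ... | yes _   = ℕP.≤-trans (s≤s (increasing⇒≤lisGe sub inc)) (ℕP.m≤m⊔n _ (lisGe b w))
  ... | no b≰x = ⊥-elim (b≰x b≤x)

  lisGe-witness : ∀ b w → ∃ λ xs → xs ⊆ w × IncreasingFrom b xs × length xs ≡ lisGe b w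
  lisGe-witness b [] = [] , [] , tt , refl
  lisGe-witness b (y ∷ w) with b ≤? y
  ... | no _ = let xs , sub , inc , len = lisGe-witness b w in xs , y ∷ʳ sub , inc , len
  ... | yes b≤y with ℕP.⊔-sel (suc (lisGe (suc y) w)) (lisGe b w)
  ...   | inj₁ eq = let xs , sub , inc , len = lisGe-witness (suc y) w
                    in y ∷ xs , refl ∷ sub , (b≤y , inc) , trans (cong suc len) (sym eq)
  ...   | inj₂ eq = let xs , sub , inc , len = lisGe-witness b w
                    in xs , y ∷ʳ sub , inc , trans len (sym eq)

  lis≤ : ∀ {n} → (∀ {xs} → xs ⊆ w → IncreasingFrom 0 xs → length xs ≤ n) → lis w ≤ n
  lis≤ {w} bound with lisGe-witness 0 w
  ... | xs , sub , inc , len = subst (_≤ _) len (bound sub inc)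

  lis≤length : lis w ≤ length w
  lis≤length {w} = lis≤ {w} (λ sub _ → length-mono-≤ sub)

  lis≤2 : ¬ Contains123 w → lis w ≤ 2
  lis≤2 no123 = lis≤ bound
    where
    bound : ∀ {xs} → _ ⊆ _ → IncreasingFrom 0 xs → length xs ≤ 2
    bound {[]}                  _   _                           = z≤n
    bound {_ ∷ []}              _   _                           = s≤s z≤n
    bound {_ ∷ _ ∷ []}          _   _                           = s≤s (s≤s z≤n)
    bound {a ∷ b ∷ c ∷ rest}    sub (_ , a<b , b<c , _)         =
      ⊥-elim (no123 (a , b , c , ⊆-trans (refl ∷ refl ∷ refl ∷ minimum rest) sub , a<b , b<c))

  lis≡2 : Avoids w → (x ∷ y ∷ []) ⊆ w → x < y → lis w ≡ 2
  lis≡2 avoids sub x<y = ℕP.≤-antisym (lis≤2 (proj₁ avoids)) (increasing⇒≤lisGe sub (z≤n , x<y , tt))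

  lis-shape : (s : Shape k) → HasShape s w → lis w ≡ lisShape s
  lis-shape {w = []} ε _ = refl
  lis-shape {w = x ∷ []} π1 _ =
    ℕP.≤-antisym (lis≤length {w = x ∷ []}) (increasing⇒≤lisGe {xs = x ∷ []} (refl ∷ []) (z≤n , tt))
  lis-shape {w = x ∷ y ∷ []} π12 x<y =
    ℕP.≤-antisym (lis≤length {w = x ∷ y ∷ []})
                 (increasing⇒≤lisGe {xs = x ∷ y ∷ []} (refl ∷ refl ∷ []) (z≤n , x<y , tt))
  lis-shape {w = x ∷ y ∷ []} π21 y<x =
    ℕP.≤-antisym (lis≤ {w = x ∷ y ∷ []} decreasing)
                 (increasing⇒≤lisGe {xs = x ∷ []} {w = x ∷ y ∷ []} (refl ∷ _ ∷ʳ []) (z≤n , tt))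
    where
    decreasing : ∀ {xs} → xs ⊆ x ∷ y ∷ [] → IncreasingFrom 0 xs → length xs ≤ 1
    decreasing {[]}        _                 _             = z≤n
    decreasing {_ ∷ []}    _                 _             = s≤s z≤n
    decreasing {_ ∷ _ ∷ _} (refl ∷ refl ∷ _) (_ , x<y , _) = ⊥-elim (ℕP.<-asym x<y y<x)
    decreasing {_ ∷ _ ∷ _} (refl ∷ _ ∷ʳ ())  _
    decreasing {_ ∷ _ ∷ _} (_ ∷ʳ refl ∷ ())  _
    decreasing {_ ∷ _ ∷ _} (_ ∷ʳ _ ∷ʳ ())    _
  lis-shape {w = _ ∷ _ ∷ _ ∷ []} π132 h@(x<z , _) = lis≡2 (shape⇒avoids π132 h) (refl ∷ _ ∷ʳ refl ∷ []) x<z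
  lis-shape {w = _ ∷ _ ∷ _ ∷ []} π231 h@(_ , x<y) = lis≡2 (shape⇒avoids π231 h) (refl ∷ refl ∷ _ ∷ʳ []) x<y
  lis-shape {w = _ ∷ _ ∷ _ ∷ []} π213 h@(_ , x<z) = lis≡2 (shape⇒avoids π213 h) (refl ∷ _ ∷ʳ refl ∷ []) x<z
  lis-shape {w = _ ∷ _ ∷ _ ∷ []} π312 h@(y<z , _) = lis≡2 (shape⇒avoids π312 h) (_ ∷ʳ refl ∷ refl ∷ []) y<z
  lis-shape {w = _ ∷ _ ∷ _ ∷ _ ∷ []} π2143 h@(_ , x<u , _) =
    lis≡2 (shape⇒avoids π2143 h) (refl ∷ _ ∷ʳ _ ∷ʳ refl ∷ []) x<u
  lis-shape {w = _ ∷ _ ∷ _ ∷ _ ∷ []} π2413 h@(_ , x<u , _) =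
    lis≡2 (shape⇒avoids π2413 h) (refl ∷ _ ∷ʳ _ ∷ʳ refl ∷ []) x<u
  lis-shape {w = _ ∷ _ ∷ _ ∷ _ ∷ []} π3142 h@(_ , _ , x<z) =
    lis≡2 (shape⇒avoids π3142 h) (refl ∷ _ ∷ʳ refl ∷ _ ∷ʳ []) x<z
  lis-shape {w = _ ∷ _ ∷ _ ∷ _ ∷ []} π3412 h@(_ , _ , x<y) =
    lis≡2 (shape⇒avoids π3412 h) (refl ∷ refl ∷ _ ∷ʳ _ ∷ʳ []) x<y

  -- The words along the border

  inBox : (a b : ℕ) (sq : ℕ × ℕ) → Dec (proj₁ sq < a × proj₂ sq < b)
  inBox a b sq = (proj₁ sq <? a) ×-dec (proj₂ sq <? b)

  rowsInBox : ∀ (f : ℕ → ℕ) A a b R →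
    (∀ {i} → f i < A → i < a) → (∀ {i} → i < a → f i < A) →
    map proj₂ (filter (inBox A b) (zip (applyUpTo f (length R)) R)) ≡ filter (_<? b) (take a R)
  rowsInBox f A zero    b []      _  _    = refl
  rowsInBox f A (suc a) b []      _  _    = refl
  rowsInBox f A zero    b (r ∷ R) to from =
    trans (cong (map proj₂) (filter-reject (inBox A b) λ (f0<A , _) → ℕP.n≮0 (to f0<A)))
          (rowsInBox (f ∘ suc) A zero b R (λ lt → ⊥-elim (ℕP.n≮0 (to lt))) λ ())
  rowsInBox f A (suc a) b (r ∷ R) to from with r <? b
  ... | yes r<b = begin
    map proj₂ (filter (inBox A b) ((f 0 , r) ∷ rest))
      ≡⟨ cong (map proj₂) (filter-accept (inBox A b) (from (s≤s z≤n) , r<b)) ⟩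
    r ∷ map proj₂ (filter (inBox A b) rest)
      ≡⟨ cong (r ∷_) (rowsInBox (f ∘ suc) A a b R (ℕP.≤-pred ∘ to) (from ∘ s≤s)) ⟩
    r ∷ filter (_<? b) (take a R)
      ≡⟨ filter-accept (_<? b) r<b ⟨
    filter (_<? b) (r ∷ take a R) ∎
    where open ≡-Reasoning
          rest = zip (applyUpTo (f ∘ suc) (length R)) R
  ... | no r≮b = begin
    map proj₂ (filter (inBox A b) ((f 0 , r) ∷ rest))
      ≡⟨ cong (map proj₂) (filter-reject (inBox A b) (r≮b ∘ proj₂)) ⟩
    map proj₂ (filter (inBox A b) rest)
      ≡⟨ rowsInBox (f ∘ suc) A a b R (ℕP.≤-pred ∘ to) (from ∘ s≤s) ⟩
    filter (_<? b) (take a R)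
      ≡⟨ filter-reject (_<? b) r≮b ⟨
    filter (_<? b) (r ∷ take a R) ∎
    where open ≡-Reasoning
          rest = zip (applyUpTo (f ∘ suc) (length R)) R

  wordAt-filter-take : ∀ R a b → wordAt R (a , b) ≡ filter (_<? b) (take a R)
  wordAt-filter-take R a b = rowsInBox (λ i → i) a a b R (λ lt → lt) (λ lt → lt)

  take-length-++ : ∀ (P X : List ℕ) → take (length P) (P ++ X) ≡ P
  take-length-++ []      X = refl
  take-length-++ (x ∷ P) X = cong (x ∷_) (take-length-++ P X)

  filter-<-filter-< : ∀ {c d} xs → c ≤ d → filter (_<? c) (filter (_<? d) xs) ≡ filter (_<? c) xs
  filter-<-filter-< [] _ = refl
  filter-<-filter-< {c} {d} (x ∷ xs) c≤d with x <? d
  ... | yes x<d = trans (cong (filter (_<? c)) (filter-accept (_<? d) x<d)) (lemma (x <? c))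
    where
    lemma : Dec (x < c) → filter (_<? c) (x ∷ filter (_<? d) xs) ≡ filter (_<? c) (x ∷ xs)
    lemma (yes x<c) = trans (filter-accept (_<? c) x<c)
                            (trans (cong (x ∷_) (filter-<-filter-< xs c≤d)) (sym (filter-accept (_<? c) x<c)))
    lemma (no x≮c)  = trans (filter-reject (_<? c) x≮c)
                            (trans (filter-<-filter-< xs c≤d) (sym (filter-reject (_<? c) x≮c)))
  ... | no x≮d = trans (cong (filter (_<? c)) (filter-reject (_<? d) x≮d))
                       (trans (filter-<-filter-< xs c≤d) (sym (filter-reject (_<? c) x≮c)))
    where x≮c = λ x<c → x≮d (ℕP.<-≤-trans x<c c≤d)

  -- The words R ∩ Γ(V) at the border vertices from V = (a , b) on, where w is the word
  -- of the first a columns and Rs lists the rows of the remaining ones.  (An east step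
  -- with no column left is junk; it does not occur for full placements.)
  wordsAlong : List ℕ → List ℕ → ℕ → Path → List (List ℕ)
  wordsAlong w Rs       b []      = w ∷ []
  wordsAlong w Rs       b (S ∷ p) = w ∷ wordsAlong (filter (_<? b ∸ 1) w) Rs (b ∸ 1) p
  wordsAlong w []       b (E ∷ p) = w ∷ []
  wordsAlong w (r ∷ Rs) b (E ∷ p) = w ∷ wordsAlong (w ++ [ r ]) Rs b p

  wordAt-prefix : ∀ P Rs b → wordAt (P ++ Rs) (length P , b) ≡ filter (_<? b) P
  wordAt-prefix P Rs b =
    trans (wordAt-filter-take (P ++ Rs) (length P) b) (cong (filter (_<? b)) (take-length-++ P Rs))

  wordsAlong-wordAt : ∀ P Rs b p → Pointwise _<_ Rs (colHeightsFrom b p) →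
    map (wordAt (P ++ Rs)) (verticesFrom (length P) b p) ≡ wordsAlong (filter (_<? b) P) Rs b p
  wordsAlong-wordAt P Rs b [] _ = cong [_] (wordAt-prefix P Rs b)
  wordsAlong-wordAt P (r ∷ Rs) b (E ∷ p) (r<b ∷ inBoard) =
    cong₂ _∷_ (wordAt-prefix P (r ∷ Rs) b) (begin
      map (wordAt (P ++ r ∷ Rs)) (verticesFrom (suc (length P)) b p)
        ≡⟨ cong₂ (λ R a → map (wordAt R) (verticesFrom a b p)) (++-assoc P [ r ] Rs) length-snoc ⟨
      map (wordAt ((P ++ [ r ]) ++ Rs)) (verticesFrom (length (P ++ [ r ])) b p)
        ≡⟨ wordsAlong-wordAt (P ++ [ r ]) Rs b p inBoard ⟩
      wordsAlong (filter (_<? b) (P ++ [ r ])) Rs b p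
        ≡⟨ cong (λ w → wordsAlong w Rs b p) filter-snoc ⟩
      wordsAlong (filter (_<? b) P ++ [ r ]) Rs b p ∎)
    where
    open ≡-Reasoning
    length-snoc : length (P ++ [ r ]) ≡ suc (length P)
    length-snoc = trans (length-++ P) (ℕP.+-comm (length P) 1)
    filter-snoc : filter (_<? b) (P ++ [ r ]) ≡ filter (_<? b) P ++ [ r ]
    filter-snoc = trans (filter-++ (_<? b) P [ r ]) (cong (filter (_<? b) P ++_) (filter-accept (_<? b) r<b))
  wordsAlong-wordAt P Rs b (S ∷ p) inBoard =
    cong₂ _∷_ (wordAt-prefix P Rs b)
      (trans (wordsAlong-wordAt P Rs (b ∸ 1) p inBoard)
             (cong (λ w → wordsAlong w Rs (b ∸ 1) p) (sym (filter-<-filter-< P (ℕP.m∸n≤m b 1)))))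

  label : List ℕ → ℤ → ℤ
  label w h = + 2 ℤ.* + lis w ℤ.- h

  jseq-wordsAlong : ∀ n F R → Pointwise _<_ R (colHeights n F) →
    jseq n F R ≡ zipWith label (wordsAlong [] R n F) (heights F)
  jseq-wordsAlong n F R inBoard = begin
    jseq n F R
      ≡⟨ zipWith-map label (wordAt R) (λ h → h) (vertices n F) (heights F) ⟨
    zipWith label (map (wordAt R) (vertices n F)) (map (λ h → h) (heights F))
      ≡⟨ cong₂ (zipWith label) (wordsAlong-wordAt [] R n F inBoard) (map-id (heights F)) ⟩
    zipWith label (wordsAlong [] R n F) (heights F) ∎
    where open ≡-Reasoning

  -- The shapes of the words R ∩ Γ(V) along the border, labelled by 2ℓ − h: an east
  -- step appends the row of the next rook, a south step from y = m + 1 drops the row m,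
  -- which is then the largest entry.
  data ShapeRun : Shape k → Path → List ℤ → Set where
    end   : ShapeRun ε [] (jOf ε ∷ [])
    east  : {s : Shape k} {t : Shape (suc k)} →
            AppendLast s t → ShapeRun t p js → ShapeRun s (E ∷ p) (jOf s ∷ js)
    south : {s : Shape (suc k)} →
            ShapeRun (deleteMax s) p js → ShapeRun s (S ∷ p) (jOf s ∷ js)

  -- A shape run together with the words realising it, from a vertex V = (a , b):
  -- w is the word of R ∩ Γ(V) and Rs lists the rows of the columns right of V.
  data WordRun : Shape k → List ℕ → List ℕ → ℕ → Path → List ℤ → Set where
    end   : WordRun ε [] [] b [] (jOf ε ∷ [])
    east  : {s : Shape k} {t : Shape (suc k)} →
            HasShape s w → AppendLast s t → r < b → WordRun t (w ++ [ r ]) Rs b p js →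
            WordRun s w (r ∷ Rs) b (E ∷ p) (jOf s ∷ js)
    south : {s : Shape (suc k)} →
            HasShape s w → All (_< suc m) w → m ∈ w → WordRun (deleteMax s) (filter (_<? m) w) Rs m p js →
            WordRun s w Rs (suc m) (S ∷ p) (jOf s ∷ js)

  forget : {s : Shape k} → WordRun s w Rs b p js → ShapeRun s p js
  forget end               = end
  forget (east _ step _ W) = east step (forget W)
  forget (south _ _ _ W)   = south (forget W)

  wordRun-shape : {s : Shape k} → WordRun s w Rs b p js → HasShape s w
  wordRun-shape end                  = tt
  wordRun-shape (east shape _ _ _)   = shape
  wordRun-shape (south shape _ _ _)  = shape

  wordRun-inBoard : {s : Shape k} → WordRun s w Rs b p js → Pointwise _<_ Rs (colHeightsFrom b p)
  wordRun-inBoard end               = []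
  wordRun-inBoard (east _ _ r<b W)  = r<b ∷ wordRun-inBoard W
  wordRun-inBoard (south _ _ _ W)   = wordRun-inBoard W

  wordRun-avoids : {s : Shape k} → WordRun s w Rs b p js → All Avoids (wordsAlong w Rs b p)
  wordRun-avoids end                         = shape⇒avoids ε tt ∷ []
  wordRun-avoids {s = s} (east shape _ _ W)  = shape⇒avoids s shape ∷ wordRun-avoids W
  wordRun-avoids {s = s} (south shape _ _ W) = shape⇒avoids s shape ∷ wordRun-avoids W

  heightsFrom-suc : ∀ k p → heightsFrom (+ k ℤ.+ + 1) p ≡ heightsFrom (+ suc k) p
  heightsFrom-suc k p = cong (λ h → heightsFrom (+ h) p) (ℕP.+-comm k 1)

  label-shape : (s : Shape k) → HasShape s w → label w (+ k) ≡ jOf s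
  label-shape s shape rewrite lis-shape s shape = jShape-def s

  wordRun-labels : {s : Shape k} → WordRun s w Rs b p js →
                   zipWith label (wordsAlong w Rs b p) (heightsFrom (+ k) p) ≡ js
  wordRun-labels end = refl
  wordRun-labels {k = k} {s = s} (east shape _ _ W) =
    cong₂ _∷_ (label-shape s shape) (trans (cong (zipWith label _) (heightsFrom-suc k _)) (wordRun-labels W))
  wordRun-labels {s = s} (south shape _ _ W) = cong₂ _∷_ (label-shape s shape) (wordRun-labels W)

  insert-at : ℕ → ℕ → List ℕ → List ℕ
  insert-at zero    x xs       = x ∷ xs
  insert-at (suc i) x []       = x ∷ []
  insert-at (suc i) x (y ∷ xs) = y ∷ insert-at i x xs

  insert-at-↭ : ∀ i x xs → insert-at i x xs ↭ x ∷ xs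
  insert-at-↭ zero    x xs       = ↭-refl
  insert-at-↭ (suc i) x []       = ↭-refl
  insert-at-↭ (suc i) x (y ∷ xs) = ↭-trans (↭-prep y (insert-at-↭ i x xs)) (↭-swap y x ↭-refl)

  ∈-insert-at : ∀ i x xs → x ∈ insert-at i x xs
  ∈-insert-at i x xs = ∈-resp-↭ (↭-sym (insert-at-↭ i x xs)) (here refl)

  filter-insert-at : ∀ i xs → All (_< m) xs → filter (_<? m) (insert-at i m xs) ≡ xs
  filter-insert-at {m} zero    xs       below      =
    trans (filter-reject (_<? m) (ℕP.<-irrefl refl)) (filter-all (_<? m) below)
  filter-insert-at {m} (suc i) []       []         = filter-reject (_<? m) (ℕP.<-irrefl refl)
  filter-insert-at {m} (suc i) (x ∷ xs) (x<m ∷ below) =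
    trans (filter-accept (_<? m) x<m) (cong (x ∷_) (filter-insert-at i xs below))

  shape-max : (s : Shape (suc k)) → HasShape s w → ∃ λ x → ∃ λ w′ →
    w ≡ insert-at (maxPosition s) x w′ × All (_< x) w′ × HasShape (deleteMax s) w′
  shape-max {w = x ∷ []} π1 _ = x , [] , refl , [] , tt
  shape-max {w = x ∷ y ∷ []} π12 x<y = y , x ∷ [] , refl , x<y ∷ [] , tt
  shape-max {w = x ∷ y ∷ []} π21 y<x = x , y ∷ [] , refl , y<x ∷ [] , tt
  shape-max {w = x ∷ y ∷ z ∷ []} π132 (x<z , z<y) =
    y , x ∷ z ∷ [] , refl , ℕP.<-trans x<z z<y ∷ z<y ∷ [] , x<z
  shape-max {w = x ∷ y ∷ z ∷ []} π231 (z<x , x<y) =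
    y , x ∷ z ∷ [] , refl , x<y ∷ ℕP.<-trans z<x x<y ∷ [] , z<x
  shape-max {w = x ∷ y ∷ z ∷ []} π213 (y<x , x<z) =
    z , x ∷ y ∷ [] , refl , x<z ∷ ℕP.<-trans y<x x<z ∷ [] , y<x
  shape-max {w = x ∷ y ∷ z ∷ []} π312 (y<z , z<x) =
    x , y ∷ z ∷ [] , refl , ℕP.<-trans y<z z<x ∷ z<x ∷ [] , y<z
  shape-max {w = x ∷ y ∷ z ∷ u ∷ []} π2143 (y<x , x<u , u<z) =
    z , x ∷ y ∷ u ∷ [] , refl , x<z ∷ ℕP.<-trans y<x x<z ∷ u<z ∷ [] , y<x , x<u
    where x<z = ℕP.<-trans x<u u<z
  shape-max {w = x ∷ y ∷ z ∷ u ∷ []} π2413 (z<x , x<u , u<y) =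
    y , x ∷ z ∷ u ∷ [] , refl , x<y ∷ ℕP.<-trans z<x x<y ∷ u<y ∷ [] , z<x , x<u
    where x<y = ℕP.<-trans x<u u<y
  shape-max {w = x ∷ y ∷ z ∷ u ∷ []} π3142 (y<u , u<x , x<z) =
    z , x ∷ y ∷ u ∷ [] , refl , x<z ∷ ℕP.<-trans y<u u<z ∷ u<z ∷ [] , y<u , u<x
    where u<z = ℕP.<-trans u<x x<z
  shape-max {w = x ∷ y ∷ z ∷ u ∷ []} π3412 (z<u , u<x , x<y) =
    y , x ∷ z ∷ u ∷ [] , refl , x<y ∷ ℕP.<-trans z<u u<y ∷ u<y ∷ [] , z<u , u<x
    where u<y = ℕP.<-trans u<x x<y

  shape-insert-max : (s : Shape (suc k)) → HasShape (deleteMax s) w → All (_< x) w →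
                     HasShape s (insert-at (maxPosition s) x w)
  shape-insert-max {w = []}            π1    _        _                        = tt
  shape-insert-max {w = _ ∷ []}        π12   _        (a<x ∷ [])               = a<x
  shape-insert-max {w = _ ∷ []}        π21   _        (a<x ∷ [])               = a<x
  shape-insert-max {w = _ ∷ _ ∷ []}    π132  a<b      (_ ∷ b<x ∷ [])           = a<b , b<x
  shape-insert-max {w = _ ∷ _ ∷ []}    π231  b<a      (a<x ∷ _ ∷ [])           = b<a , a<x
  shape-insert-max {w = _ ∷ _ ∷ []}    π213  b<a      (a<x ∷ _ ∷ [])           = b<a , a<x
  shape-insert-max {w = _ ∷ _ ∷ []}    π312  a<b      (_ ∷ b<x ∷ [])           = a<b , b<x
  shape-insert-max {w = _ ∷ _ ∷ _ ∷ []} π2143 (b<a , a<c) (_ ∷ _ ∷ c<x ∷ [])   = b<a , a<c , c<x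
  shape-insert-max {w = _ ∷ _ ∷ _ ∷ []} π2413 (b<a , a<c) (_ ∷ _ ∷ c<x ∷ [])   = b<a , a<c , c<x
  shape-insert-max {w = _ ∷ _ ∷ _ ∷ []} π3142 (b<c , c<a) (a<x ∷ _ ∷ _ ∷ [])   = b<c , c<a , a<x
  shape-insert-max {w = _ ∷ _ ∷ _ ∷ []} π3412 (b<c , c<a) (a<x ∷ _ ∷ _ ∷ [])   = b<c , c<a , a<x

  shape-max-at : (s : Shape (suc k)) → HasShape s w → All (_< suc m) w → m ∈ w →
    ∃ λ w′ → w ≡ insert-at (maxPosition s) m w′ × All (_< m) w′ × HasShape (deleteMax s) w′
  shape-max-at {m = m} s shape below m∈w with shape-max s shape
  ... | x , w′ , refl , below-x , shape′ with ∈-resp-↭ (insert-at-↭ _ x w′) m∈w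
  ...   | here refl  = w′ , refl , below-x , shape′
  ...   | there m∈w′ = ⊥-elim (ℕP.<⇒≱ (All.lookup below-x m∈w′) x≤m)
    where x≤m = ℕP.≤-pred (All.lookup below (∈-insert-at _ x w′))

  IsPermutation : ℕ → List ℕ → Set
  IsPermutation b xs = Unique xs × All (_< b) xs × (∀ {r} → r < b → r ∈ xs)

  unique-resp-↭ : xs ↭ ys → Unique xs → Unique ys
  unique-resp-↭ xs↭ys = Permutationₛ.Unique-resp-↭ (setoid ℕ) (↭⇒↭ₛ xs↭ys)

  isPermutation-↭ : xs ↭ ys → IsPermutation b xs → IsPermutation b ys
  isPermutation-↭ xs↭ys (unique , below , covers) =
    unique-resp-↭ xs↭ys unique , All-resp-↭ xs↭ys below , ∈-resp-↭ xs↭ys ∘ covers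

  isPermutation-∷ : IsPermutation m xs → IsPermutation (suc m) (m ∷ xs)
  isPermutation-∷ {m} (unique , below , covers) =
    All.map (λ x<m m≡x → ℕP.<-irrefl (sym m≡x) x<m) below ∷ unique ,
    ℕP.n<1+n m ∷ All.map ℕP.m<n⇒m<1+n below ,
    cover
    where
    cover : r < suc m → r ∈ m ∷ _
    cover r<1+m with ℕP.m<1+n⇒m<n∨m≡n r<1+m
    ... | inj₁ r<m  = there (covers r<m)
    ... | inj₂ refl = here refl

  isPermutation-∷⁻ : IsPermutation (suc m) (m ∷ xs) → IsPermutation m xs
  isPermutation-∷⁻ {m} ((m∉ ∷ unique) , (_ ∷ below) , covers) =
    unique , All.zipWith (λ (x<1+m , m≢x) → ℕP.≤∧≢⇒< (ℕP.≤-pred x<1+m) (m≢x ∘ sym)) (below , m∉) ,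
    cover
    where
    cover : r < m → r ∈ _
    cover r<m with covers (ℕP.m<n⇒m<1+n r<m)
    ... | here refl = ⊥-elim (ℕP.<-irrefl refl r<m)
    ... | there r∈  = r∈

  isPermutation⇒∉ : IsPermutation b (w ++ r ∷ Rs) → r ∉ w
  isPermutation⇒∉ {w = w} {r = r} {Rs = Rs} (unique , _) r∈w =
    Unique[x∷xs]⇒x∉xs (unique-resp-↭ (shift r w Rs) unique) (∈-++⁺ˡ r∈w)

  -- From a placement to a run

  data DyckFrom (Allowed : ℤ → Set) : ℕ → Path → Set where
    []   : DyckFrom Allowed 0 []
    up   : Allowed (+ suc k) → DyckFrom Allowed (suc k) p → DyckFrom Allowed k (E ∷ p)
    down : DyckFrom Allowed k p → DyckFrom Allowed (suc k) (S ∷ p)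

  inBoard⇒below : ∀ y p → Pointwise _<_ Rs (colHeightsFrom y p) → All (_< y) Rs
  inBoard⇒below y []      []               = []
  inBoard⇒below y (E ∷ p) (r<y ∷ inBoard)  = r<y ∷ inBoard⇒below y p inBoard
  inBoard⇒below y (S ∷ p) inBoard          =
    All.map (λ r<y-1 → ℕP.<-≤-trans r<y-1 (ℕP.m∸n≤m y 1)) (inBoard⇒below (y ∸ 1) p inBoard)

  wordsAlong-head : ∀ {P : List ℕ → Set} p → All P (wordsAlong w Rs b p) → P w
  wordsAlong-head []      (pw ∷ _) = pw
  wordsAlong-head (S ∷ _) (pw ∷ _) = pw
  wordsAlong-head {Rs = []}    (E ∷ _) (pw ∷ _) = pw
  wordsAlong-head {Rs = _ ∷ _} (E ∷ _) (pw ∷ _) = pw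

  largest-in-word : ∀ w → IsPermutation (suc m) (w ++ Rs) → All (_< m) Rs → All (_< suc m) w × m ∈ w
  largest-in-word {m} w (_ , below , covers) Rs-below with ∈-++⁻ w (covers (ℕP.n<1+n m))
  ... | inj₁ m∈w  = All.++⁻ˡ w below , m∈w
  ... | inj₂ m∈Rs = ⊥-elim (ℕP.<-irrefl refl (All.lookup Rs-below m∈Rs))

  avoiding⇒wordRun : ∀ {Allowed} {s : Shape k} → DyckFrom Allowed k p → HasShape s w →
    IsPermutation b (w ++ Rs) → Pointwise _<_ Rs (colHeightsFrom b p) → All Avoids (wordsAlong w Rs b p) →
    ∃ (WordRun s w Rs b p)
  avoiding⇒wordRun {w = []}    {s = ε} [] _  _ [] _ = _ , end
  avoiding⇒wordRun {w = _ ∷ _} {s = ε} [] () _ _  _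
  avoiding⇒wordRun {w = w} {b = b} {Rs = r ∷ Rs} {s = s} (up _ D) shape perm (r<b ∷ inBoard) (_ ∷ avoids)
    with appendLast-shape s w shape (isPermutation⇒∉ perm) (wordsAlong-head _ avoids)
  ... | t , step , shape′ =
    _ , east shape step r<b (proj₂ (avoiding⇒wordRun D shape′ perm′ inBoard avoids))
    where perm′ = subst (IsPermutation b) (sym (++-assoc w [ r ] Rs)) perm
  avoiding⇒wordRun {w = w} {b = zero} {s = s} (down D) shape (_ , below , _) _ _ =
    let x , w′ , w≡ , _ = shape-max s shape
    in ⊥-elim (ℕP.n≮0 (All.lookup (All.++⁻ˡ w below) (subst (x ∈_) (sym w≡) (∈-insert-at _ x w′))))
  avoiding⇒wordRun {p = S ∷ p} {w = w} {b = suc m} {Rs = Rs} {s = s} (down D) shape perm inBoard (_ ∷ avoids)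
    with largest-in-word w perm (inBoard⇒below m p inBoard)
  ... | below-w , m∈w with shape-max-at s shape below-w m∈w
  ...   | w′ , refl , below′ , shape′ =
    _ , south shape below-w m∈w (subst (λ v → WordRun _ v Rs m p (proj₁ W)) (sym filter≡) (proj₂ W))
    where
    filter≡ = filter-insert-at (maxPosition s) w′ below′
    perm′ = isPermutation-∷⁻ (isPermutation-↭ (++⁺ʳ Rs (insert-at-↭ (maxPosition s) m w′)) perm)
    W = avoiding⇒wordRun D shape′ perm′ inBoard
          (subst (λ v → All Avoids (wordsAlong v Rs m p)) filter≡ avoids)

  -- The labels determine the run

  -- Siblings are told apart by the labels: directly for π12 and π21, and for the
  -- others at the next south step, where their parents are again siblings.
  siblings-equal : {s : Shape k} {t t′ : Shape (suc k)} → AppendLast s t → AppendLast s t′ →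
                   ShapeRun t p js → ShapeRun t′ p js → t ≡ t′
  siblings-equal to1    to1    _ _ = refl
  siblings-equal to12   to12   _ _ = refl
  siblings-equal to21   to21   _ _ = refl
  siblings-equal to231  to231  _ _ = refl
  siblings-equal to132  to132  _ _ = refl
  siblings-equal to312  to312  _ _ = refl
  siblings-equal to213  to213  _ _ = refl
  siblings-equal to2413 to2413 _ _ = refl
  siblings-equal to3412 to3412 _ _ = refl
  siblings-equal to2143 to2143 _ _ = refl
  siblings-equal to3142 to3142 _ _ = refl
  siblings-equal to12   to21   (east _ _) ()
  siblings-equal to12   to21   (south _)  ()
  siblings-equal to21   to12   (east _ _) ()
  siblings-equal to21   to12   (south _)  ()
  siblings-equal to231  to132  (east _ _) (east () _)
  siblings-equal to132  to231  (east () _) _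
  siblings-equal to312  to213  (east () _) _
  siblings-equal to213  to312  (east _ _) (east () _)
  siblings-equal to231  to132  (south R) (south R′) with () ← siblings-equal to21 to12 R R′
  siblings-equal to132  to231  (south R) (south R′) with () ← siblings-equal to12 to21 R R′
  siblings-equal to312  to213  (south R) (south R′) with () ← siblings-equal to12 to21 R R′
  siblings-equal to213  to312  (south R) (south R′) with () ← siblings-equal to21 to12 R R′
  siblings-equal to2413 to3412 (south R) (south R′) with () ← siblings-equal to213 to312 R R′
  siblings-equal to3412 to2413 (south R) (south R′) with () ← siblings-equal to312 to213 R R′
  siblings-equal to2143 to3142 (south R) (south R′) with () ← siblings-equal to213 to312 R R′
  siblings-equal to3142 to2143 (south R) (south R′) with () ← siblings-equal to312 to213 R R′
  siblings-equal to2413 to3412 (east () _) _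
  siblings-equal to3412 to2413 (east () _) _
  siblings-equal to2143 to3142 (east () _) _
  siblings-equal to3142 to2143 (east () _) _

  insert-max-filter : (s : Shape (suc k)) → HasShape s w → All (_< suc m) w → m ∈ w →
                      insert-at (maxPosition s) m (filter (_<? m) w) ≡ w
  insert-max-filter s shape below m∈w with shape-max-at s shape below m∈w
  ... | w′ , refl , below′ , _ =
    cong (insert-at (maxPosition s) _) (filter-insert-at (maxPosition s) w′ below′)

  wordRun-unique : {s : Shape k} {w w′ Rs Rs′ : List ℕ} →
                   WordRun s w Rs b p js → WordRun s w′ Rs′ b p js → w ≡ w′ × Rs ≡ Rs′
  wordRun-unique end end = refl , refl
  wordRun-unique {w = w} {w′ = w′} (east _ step _ W) (east _ step′ _ W′)
    with refl ← siblings-equal step step′ (forget W) (forget W′)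
    with w++r≡w′++r′ , refl ← wordRun-unique W W′
    with refl , refl ← ∷ʳ-injective w w′ w++r≡w′++r′ = refl , refl
  wordRun-unique {s = s} {w = w} {w′ = w′} (south shape below m∈w W) (south shape′ below′ m∈w′ W′)
    with filter≡ , refl ← wordRun-unique W W′ = w≡w′ , refl
    where
    open ≡-Reasoning
    w≡w′ : w ≡ w′
    w≡w′ = begin
      w                                                 ≡⟨ insert-max-filter s shape below m∈w ⟨
      insert-at (maxPosition s) _ (filter (_<? _) w)    ≡⟨ cong (insert-at (maxPosition s) _) filter≡ ⟩
      insert-at (maxPosition s) _ (filter (_<? _) w′)   ≡⟨ insert-max-filter s shape′ below′ m∈w′ ⟩
      w′                                                ∎

  -- From a run back to a placement

  appendLast-unsnoc : {s : Shape k} {t : Shape (suc k)} → AppendLast s t → HasShape t w′ →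
                      ∃ λ w → ∃ λ r → w′ ≡ w ++ [ r ] × HasShape s w
  appendLast-unsnoc {w′ = r ∷ []}         to1   _           = [] , r , refl , tt
  appendLast-unsnoc {w′ = x ∷ y ∷ []}     to12  _           = x ∷ [] , y , refl , tt
  appendLast-unsnoc {w′ = x ∷ y ∷ []}     to21  _           = x ∷ [] , y , refl , tt
  appendLast-unsnoc {w′ = x ∷ y ∷ z ∷ []} to231 (_ , x<y)   = x ∷ y ∷ [] , z , refl , x<y
  appendLast-unsnoc {w′ = x ∷ y ∷ z ∷ []} to132 (x<z , z<y) = x ∷ y ∷ [] , z , refl , ℕP.<-trans x<z z<y
  appendLast-unsnoc {w′ = x ∷ y ∷ z ∷ []} to312 (y<z , z<x) = x ∷ y ∷ [] , z , refl , ℕP.<-trans y<z z<x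
  appendLast-unsnoc {w′ = x ∷ y ∷ z ∷ []} to213 (y<x , _)   = x ∷ y ∷ [] , z , refl , y<x
  appendLast-unsnoc {w′ = x ∷ y ∷ z ∷ u ∷ []} to2413 (z<x , x<u , u<y) =
    x ∷ y ∷ z ∷ [] , u , refl , z<x , ℕP.<-trans x<u u<y
  appendLast-unsnoc {w′ = x ∷ y ∷ z ∷ u ∷ []} to3412 (z<u , u<x , x<y) =
    x ∷ y ∷ z ∷ [] , u , refl , ℕP.<-trans z<u u<x , x<y
  appendLast-unsnoc {w′ = x ∷ y ∷ z ∷ u ∷ []} to2143 (y<x , x<u , u<z) =
    x ∷ y ∷ z ∷ [] , u , refl , y<x , ℕP.<-trans x<u u<z
  appendLast-unsnoc {w′ = x ∷ y ∷ z ∷ u ∷ []} to3142 (y<u , u<x , x<z) =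
    x ∷ y ∷ z ∷ [] , u , refl , ℕP.<-trans y<u u<x , x<z

  -- Read backwards, a shape run is realised by words: an east step drops the last
  -- entry, a south step inserts a new largest row at maxPosition.
  shapeRun⇒wordRun : {s : Shape k} → ShapeRun s p js →
    ∃ λ w → ∃ λ Rs → WordRun s w Rs (countS p) p js × IsPermutation (countS p) (w ++ Rs)
  shapeRun⇒wordRun end = [] , [] , end , [] , [] , λ ()
  shapeRun⇒wordRun {p = E ∷ p} (east step R)
    with w′ , Rs , W , perm ← shapeRun⇒wordRun R
    with w , r , refl , shape ← appendLast-unsnoc step (wordRun-shape W) =
    w , r ∷ Rs , east shape step r<b W , perm′
    where
    perm′ = subst (IsPermutation (countS p)) (++-assoc w [ r ] Rs) perm
    r<b = All.lookup (proj₁ (proj₂ perm′)) (∈-++⁺ʳ w (here refl))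
  shapeRun⇒wordRun {p = S ∷ p} {s = s} (south R)
    with w′ , Rs , W , perm ← shapeRun⇒wordRun R =
    insert-at i top w′ , Rs , south shape below m∈w W′ , perm′
    where
    top = countS p
    i = maxPosition s
    below′ = All.++⁻ˡ w′ (proj₁ (proj₂ perm))
    shape = shape-insert-max s (wordRun-shape W) below′
    below = All-resp-↭ (↭-sym (insert-at-↭ i top w′)) (ℕP.n<1+n top ∷ All.map ℕP.m<n⇒m<1+n below′)
    m∈w = ∈-insert-at i top w′
    W′ = subst (λ v → WordRun _ v Rs top p _) (sym (filter-insert-at i w′ below′)) W
    perm′ = isPermutation-↭ (↭-sym (++⁺ʳ Rs (insert-at-↭ i top w′))) (isPermutation-∷ perm)

  shapeRun-pointwise : {Q : ℤ → ℤ → Set} → (∀ {k} (s : Shape k) → Q (+ k) (jOf s)) →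
                       {s : Shape k} → ShapeRun s p js → Pointwise Q (heightsFrom (+ k) p) js
  shapeRun-pointwise q end = q ε ∷ []
  shapeRun-pointwise {k = k} {Q = Q} q {s} (east _ R) =
    q s ∷ subst (λ hs → Pointwise Q hs _) (sym (heightsFrom-suc k _)) (shapeRun-pointwise q R)
  shapeRun-pointwise q {s} (south R) = q s ∷ shapeRun-pointwise q R

  pointwise⇒Allˡ : {P : ℤ → Set} {hs js : List ℤ} → Pointwise (λ h _ → P h) hs js → All P hs
  pointwise⇒Allˡ []       = []
  pointwise⇒Allˡ (h ∷ pw) = h ∷ pointwise⇒Allˡ pw

  pointwise⇒Allʳ : {P : ℤ → Set} {hs js : List ℤ} → Pointwise (λ _ j → P j) hs js → All P js
  pointwise⇒Allʳ []       = []
  pointwise⇒Allʳ (j ∷ pw) = j ∷ pointwise⇒Allʳ pw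

  shape-E2 : (s : Shape k) → E2cond (+ k) (jOf s)
  shape-E2 ε     = (λ { (inj₁ ()) ; (inj₂ ()) }) , (λ _ → refl) , (λ ())
  shape-E2 π1    = (λ _ → refl) , (λ { (inj₁ ()) ; (inj₂ ()) }) , (λ ())
  shape-E2 π12   = (λ { (inj₁ ()) ; (inj₂ ()) }) , (λ { (inj₁ ()) ; (inj₂ ()) }) , (λ _ → inj₂ refl)
  shape-E2 π21   = (λ { (inj₁ ()) ; (inj₂ ()) }) , (λ { (inj₁ ()) ; (inj₂ ()) }) , (λ _ → inj₁ refl)
  shape-E2 π132  = (λ _ → refl) , (λ { (inj₁ ()) ; (inj₂ ()) }) , (λ ())
  shape-E2 π231  = (λ _ → refl) , (λ { (inj₁ ()) ; (inj₂ ()) }) , (λ ())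
  shape-E2 π213  = (λ _ → refl) , (λ { (inj₁ ()) ; (inj₂ ()) }) , (λ ())
  shape-E2 π312  = (λ _ → refl) , (λ { (inj₁ ()) ; (inj₂ ()) }) , (λ ())
  shape-E2 π2143 = (λ { (inj₁ ()) ; (inj₂ ()) }) , (λ _ → refl) , (λ ())
  shape-E2 π2413 = (λ { (inj₁ ()) ; (inj₂ ()) }) , (λ _ → refl) , (λ ())
  shape-E2 π3142 = (λ { (inj₁ ()) ; (inj₂ ()) }) , (λ _ → refl) , (λ ())
  shape-E2 π3412 = (λ { (inj₁ ()) ; (inj₂ ()) }) , (λ _ → refl) , (λ ())

  jShape≤size : (s : Shape k) → jShape s ≤ k
  jShape≤size ε     = z≤n
  jShape≤size π1    = s≤s z≤n
  jShape≤size π12   = s≤s (s≤s z≤n)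
  jShape≤size π21   = z≤n
  jShape≤size π132  = s≤s z≤n
  jShape≤size π231  = s≤s z≤n
  jShape≤size π213  = s≤s z≤n
  jShape≤size π312  = s≤s z≤n
  jShape≤size π2143 = z≤n
  jShape≤size π2413 = z≤n
  jShape≤size π3142 = z≤n
  jShape≤size π3412 = z≤n

  size<5 : Shape k → k < 5
  size<5 {0} _ = s≤s z≤n
  size<5 {1} _ = s≤s (s≤s z≤n)
  size<5 {2} _ = s≤s (s≤s (s≤s z≤n))
  size<5 {3} _ = s≤s (s≤s (s≤s (s≤s z≤n)))
  size<5 {4} _ = ℕP.≤-refl
  size<5 {suc (suc (suc (suc (suc _))))} ()

  Adjacent : ℕ → ℕ → Set
  Adjacent a b = b ≡ suc a ⊎ a ≡ suc b

  appendLast-adjacent : {s : Shape k} {t : Shape (suc k)} → AppendLast s t → Adjacent (jShape s) (jShape t)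
  appendLast-adjacent to1    = inj₁ refl
  appendLast-adjacent to12   = inj₁ refl
  appendLast-adjacent to21   = inj₂ refl
  appendLast-adjacent to231  = inj₂ refl
  appendLast-adjacent to132  = inj₂ refl
  appendLast-adjacent to312  = inj₁ refl
  appendLast-adjacent to213  = inj₁ refl
  appendLast-adjacent to2413 = inj₂ refl
  appendLast-adjacent to3412 = inj₂ refl
  appendLast-adjacent to2143 = inj₂ refl
  appendLast-adjacent to3142 = inj₂ refl

  deleteMax-adjacent : (s : Shape (suc k)) → Adjacent (jShape s) (jShape (deleteMax s))
  deleteMax-adjacent π1    = inj₂ refl
  deleteMax-adjacent π12   = inj₂ refl
  deleteMax-adjacent π21   = inj₁ refl
  deleteMax-adjacent π132  = inj₁ refl
  deleteMax-adjacent π231  = inj₂ refl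
  deleteMax-adjacent π213  = inj₂ refl
  deleteMax-adjacent π312  = inj₁ refl
  deleteMax-adjacent π2143 = inj₁ refl
  deleteMax-adjacent π2413 = inj₁ refl
  deleteMax-adjacent π3142 = inj₁ refl
  deleteMax-adjacent π3412 = inj₁ refl

  PathFrom : ℕ → List ℤ → ℕ → Set
  PathFrom a hs len =
    ∃ λ D → heightsFrom (+ a) D ≡ hs × countE D + a ≡ countS D × countE D + countS D ≡ len

  pathFrom-∷ : ∀ {a b hs len} → Adjacent a b → PathFrom b hs len → PathFrom a (+ a ∷ hs) (suc len)
  pathFrom-∷ {a} (inj₁ refl) (D , heights≡ , ends , total) =
    E ∷ D , cong (+ a ∷_) (trans (heightsFrom-suc a D) heights≡) ,
    trans (sym (ℕP.+-suc _ a)) ends , cong suc total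
  pathFrom-∷ {b = b} (inj₂ refl) (D , heights≡ , ends , total) =
    S ∷ D , cong (+ suc b ∷_) heights≡ ,
    trans (ℕP.+-suc _ b) (cong suc ends) , trans (ℕP.+-suc _ _) (cong suc total)

  labelPath : {s : Shape k} → ShapeRun s p js → PathFrom (jShape s) js (countE p + countS p)
  labelPath end           = [] , refl , refl , refl
  labelPath (east step R) = pathFrom-∷ (appendLast-adjacent step) (labelPath R)
  labelPath {p = S ∷ p} {s = s} (south R) =
    subst (PathFrom (jShape s) _) (sym (ℕP.+-suc (countE p) (countS p)))
          (pathFrom-∷ (deleteMax-adjacent s) (labelPath R))

  double-injective : ∀ a b → a + a ≡ b + b → a ≡ b
  double-injective zero    zero    _  = refl
  double-injective (suc a) (suc b) eq =
    cong suc (double-injective a b (ℕP.suc-injective (begin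
      suc (a + a) ≡⟨ ℕP.+-suc a a ⟨
      a + suc a   ≡⟨ ℕP.suc-injective eq ⟩
      b + suc b   ≡⟨ ℕP.+-suc b b ⟩
      suc (b + b) ∎)))
    where open ≡-Reasoning

  shapeRun⇒InE2 : ∀ {n F} → IsDyck n F → ShapeRun ε F js → ∃ λ D → heights D ≡ js × InE2 n F (D , F)
  shapeRun⇒InE2 {js = js} {n = n} {F = F} (#E , #S , _) R
    with D , heights≡ , ends , total ← labelPath R =
    D , heights≡ , refl , (#E-D , trans (sym ends′) #E-D , nonneg) , neverAbove , e2
    where
    ends′ : countE D ≡ countS D
    ends′ = trans (sym (ℕP.+-identityʳ _)) ends
    #E-D : countE D ≡ n
    #E-D = double-injective _ _ (trans (cong (λ c → countE D + c) ends′) (trans total (cong₂ _+_ #E #S)))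
    nonneg : All (+ 0 ℤ.≤_) (heights D)
    nonneg = subst (All _) (sym heights≡) (pointwise⇒Allʳ (shapeRun-pointwise (λ _ → +≤+ z≤n) R))
    neverAbove : NeverAbove D F
    neverAbove = subst (λ hs → Pointwise ℤ._≤_ hs (heights F)) (sym heights≡)
                   (Pointwise.symmetric (λ le → le) (shapeRun-pointwise (λ s → +≤+ (jShape≤size s)) R))
    e2 : Pointwise E2cond (heights F) (heights D)
    e2 = subst (Pointwise E2cond (heights F)) (sym heights≡) (shapeRun-pointwise shape-E2 R)

  shapeRun⇒heights<5 : {s : Shape k} → ShapeRun s p js → All (ℤ._< + 5) (heightsFrom (+ k) p)
  shapeRun⇒heights<5 R = pointwise⇒Allˡ (shapeRun-pointwise (λ s → +<+ (size<5 s)) R)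

  -- Runs with prescribed labels

  Below5 : ℤ → Set
  Below5 h = h ℤ.< + 5

  E2Labels : ℕ → Path → List ℤ → Set
  E2Labels k p js = Pointwise E2cond (heightsFrom (+ k) p) js

  E2Labels-east : ∀ k → Pointwise E2cond (heightsFrom (+ k ℤ.+ + 1) p) js → E2Labels (suc k) p js
  E2Labels-east k = subst (λ hs → Pointwise E2cond hs _) (heightsFrom-suc k _)

  E2-at-0 : ∀ {j} → E2cond (+ 0) j → j ≡ + 0
  E2-at-0 (_ , at0or4 , _) = at0or4 (inj₁ refl)

  E2-at-1 : ∀ {j} → E2cond (+ 1) j → j ≡ + 1
  E2-at-1 (at1or3 , _) = at1or3 (inj₁ refl)

  E2-at-2 : ∀ {j} → E2cond (+ 2) j → j ≡ + 0 ⊎ j ≡ + 2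
  E2-at-2 (_ , _ , at2) = at2 refl

  E2-at-3 : ∀ {j} → E2cond (+ 3) j → j ≡ + 1
  E2-at-3 (at1or3 , _) = at1or3 (inj₂ refl)

  E2-at-4 : ∀ {j} → E2cond (+ 4) j → j ≡ + 0
  E2-at-4 (_ , at0or4 , _) = at0or4 (inj₂ refl)

  -- s fits the labels js along p: it carries the current label, and the shapes
  -- forced by the south steps that follow carry theirs, up to the next east step,
  -- where the shape must have a child.
  Compatible : Shape k → Path → List ℤ → Set
  Compatible s p [] = ⊥
  Compatible s [] (j ∷ _) = j ≡ jOf s
  Compatible s (E ∷ _) (j ∷ _) = j ≡ jOf s × ∃ (AppendLast s)
  Compatible {zero}  s (S ∷ _) (j ∷ _) = ⊥
  Compatible {suc k} s (S ∷ p) (j ∷ js) = j ≡ jOf s × Compatible (deleteMax s) p js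

  compatible-ε : ∀ {A} → DyckFrom A 0 p → E2Labels 0 p js → Compatible ε p js
  compatible-ε []       (c ∷ []) = E2-at-0 c
  compatible-ε (up _ _) (c ∷ _)  = E2-at-0 c , π1 , to1

  compatible-π1 : ∀ {A} → DyckFrom A 1 p → E2Labels 1 p js → Compatible π1 p js
  compatible-π1 (up _ _) (c ∷ _)  = E2-at-1 c , π12 , to12
  compatible-π1 (down D) (c ∷ e2) = E2-at-1 c , compatible-ε D e2

  compatible-12-or-21 : ∀ {A} → DyckFrom A 2 p → E2Labels 2 p js →
                        Compatible π12 p js ⊎ Compatible π21 p js
  compatible-12-or-21 (up _ _) (c ∷ _) with E2-at-2 c
  ... | inj₁ j≡0 = inj₂ (j≡0 , π213 , to213)
  ... | inj₂ j≡2 = inj₁ (j≡2 , π231 , to231)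
  compatible-12-or-21 (down D) (c ∷ e2) with E2-at-2 c
  ... | inj₁ j≡0 = inj₂ (j≡0 , compatible-π1 D e2)
  ... | inj₂ j≡2 = inj₁ (j≡2 , compatible-π1 D e2)

  compatible-231-or-132 : ∀ {A} → DyckFrom A 3 p → E2Labels 3 p js →
                          Compatible π231 p js ⊎ Compatible π132 p js
  compatible-231-or-132 (up _ _) (c ∷ _) = inj₁ (E2-at-3 c , π2413 , to2413)
  compatible-231-or-132 (down D) (c ∷ e2) with compatible-12-or-21 D e2
  ... | inj₁ at12 = inj₂ (E2-at-3 c , at12)
  ... | inj₂ at21 = inj₁ (E2-at-3 c , at21)

  compatible-213-or-312 : ∀ {A} → DyckFrom A 3 p → E2Labels 3 p js →
                          Compatible π213 p js ⊎ Compatible π312 p js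
  compatible-213-or-312 (up _ _) (c ∷ _) = inj₁ (E2-at-3 c , π2143 , to2143)
  compatible-213-or-312 (down D) (c ∷ e2) with compatible-12-or-21 D e2
  ... | inj₁ at12 = inj₂ (E2-at-3 c , at12)
  ... | inj₂ at21 = inj₁ (E2-at-3 c , at21)

  compatible-2413-or-3412 : DyckFrom Below5 4 p → E2Labels 4 p js →
                            Compatible π2413 p js ⊎ Compatible π3412 p js
  compatible-2413-or-3412 (up (+<+ 5<5) _) _ = ⊥-elim (ℕP.<-irrefl refl 5<5)
  compatible-2413-or-3412 (down D) (c ∷ e2) with compatible-213-or-312 D e2
  ... | inj₁ at213 = inj₁ (E2-at-4 c , at213)
  ... | inj₂ at312 = inj₂ (E2-at-4 c , at312)

  compatible-2143-or-3142 : DyckFrom Below5 4 p → E2Labels 4 p js →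
                            Compatible π2143 p js ⊎ Compatible π3142 p js
  compatible-2143-or-3142 (up (+<+ 5<5) _) _ = ⊥-elim (ℕP.<-irrefl refl 5<5)
  compatible-2143-or-3142 (down D) (c ∷ e2) with compatible-213-or-312 D e2
  ... | inj₁ at213 = inj₁ (E2-at-4 c , at213)
  ... | inj₂ at312 = inj₂ (E2-at-4 c , at312)

  either : {s : Shape k} {t t′ : Shape (suc k)} {P : Shape (suc k) → Set} →
           AppendLast s t → AppendLast s t′ → P t ⊎ P t′ → ∃ λ u → AppendLast s u × P u
  either step _     (inj₁ pt)  = _ , step , pt
  either _    step′ (inj₂ pt′) = _ , step′ , pt′

  compatible-child : {s : Shape k} {t : Shape (suc k)} → AppendLast s t →
    DyckFrom Below5 (suc k) p → E2Labels (suc k) p js → ∃ λ t′ → AppendLast s t′ × Compatible t′ p js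
  compatible-child to1    D e2 = π1 , to1 , compatible-π1 D e2
  compatible-child to12   D e2 = either to12 to21 (compatible-12-or-21 D e2)
  compatible-child to21   D e2 = either to12 to21 (compatible-12-or-21 D e2)
  compatible-child to231  D e2 = either to231 to132 (compatible-231-or-132 D e2)
  compatible-child to132  D e2 = either to231 to132 (compatible-231-or-132 D e2)
  compatible-child to213  D e2 = either to213 to312 (compatible-213-or-312 D e2)
  compatible-child to312  D e2 = either to213 to312 (compatible-213-or-312 D e2)
  compatible-child to2413 D e2 = either to2413 to3412 (compatible-2413-or-3412 D e2)
  compatible-child to3412 D e2 = either to2413 to3412 (compatible-2413-or-3412 D e2)
  compatible-child to2143 D e2 = either to2143 to3142 (compatible-2143-or-3142 D e2)
  compatible-child to3142 D e2 = either to2143 to3142 (compatible-2143-or-3142 D e2)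

  compatible⇒shapeRun : {s : Shape k} → DyckFrom Below5 k p → E2Labels k p js → Compatible s p js → ShapeRun s p js
  compatible⇒shapeRun {s = ε} [] (_ ∷ []) refl = end
  compatible⇒shapeRun {k = k} (up _ D) (_ ∷ e2) (refl , _ , step)
    with t , step′ , compatible ← compatible-child step D (E2Labels-east k e2) =
    east step′ (compatible⇒shapeRun D (E2Labels-east k e2) compatible)
  compatible⇒shapeRun (down D) (_ ∷ e2) (refl , compatible) = south (compatible⇒shapeRun D e2 compatible)

  heightsFrom-∷ : ∀ x D → heightsFrom x D ≡ x ∷ drop 1 (heightsFrom x D)
  heightsFrom-∷ x []      = refl
  heightsFrom-∷ x (E ∷ D) = refl
  heightsFrom-∷ x (S ∷ D) = refl

  stepsFrom-up : ∀ x ys → stepsFrom x (x ℤ.+ + 1 ∷ ys) ≡ Maybe.map (E ∷_) (stepsFrom (x ℤ.+ + 1) ys)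
  stepsFrom-up x ys with (x ℤ.+ + 1) ℤ.≟ (x ℤ.+ + 1) | x ℤ.≟ (x ℤ.+ + 1) ℤ.+ + 1
  ... | yes _ | _ = refl
  ... | no ≢  | _ = ⊥-elim (≢ refl)

  stepsFrom-down : ∀ x ys → stepsFrom x (x ℤ.- + 1 ∷ ys) ≡ Maybe.map (S ∷_) (stepsFrom (x ℤ.- + 1) ys)
  stepsFrom-down x ys with (x ℤ.- + 1) ℤ.≟ (x ℤ.+ + 1) | x ℤ.≟ (x ℤ.- + 1) ℤ.+ + 1
  ... | yes eq | _     with () ← ∙-cancelˡ x _ _ eq
  ... | no _   | yes _ = refl
  ... | no _   | no ≢  = ⊥-elim (≢ (sym (trans (ℤP.+-assoc x (ℤ.- + 1) (+ 1)) (ℤP.+-identityʳ x))))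

  stepsFrom-heightsFrom : ∀ x D → stepsFrom x (drop 1 (heightsFrom x D)) ≡ just D
  stepsFrom-heightsFrom x [] = refl
  stepsFrom-heightsFrom x (E ∷ D)
    rewrite heightsFrom-∷ (x ℤ.+ + 1) D | stepsFrom-up x (drop 1 (heightsFrom (x ℤ.+ + 1) D))
          | stepsFrom-heightsFrom (x ℤ.+ + 1) D = refl
  stepsFrom-heightsFrom x (S ∷ D)
    rewrite heightsFrom-∷ (x ℤ.- + 1) D | stepsFrom-down x (drop 1 (heightsFrom (x ℤ.- + 1) D))
          | stepsFrom-heightsFrom (x ℤ.- + 1) D = refl

  pathWithHeights-heights : ∀ D → pathWithHeights (heights D) ≡ just D
  pathWithHeights-heights D rewrite heightsFrom-∷ (+ 0) D = stepsFrom-heightsFrom (+ 0) D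

  δ321-heights : ∀ n F R {D} → heights D ≡ jseq n F R → δ321 n F R ≡ just (D , F)
  δ321-heights n F R {D} heights≡ =
    cong (Maybe.map (λ D₀ → D₀ , F)) (trans (cong pathWithHeights (sym heights≡)) (pathWithHeights-heights D))

  All-heightsFrom-head : ∀ {P : ℤ → Set} {x} p → All P (heightsFrom x p) → P x
  All-heightsFrom-head []      (px ∷ _) = px
  All-heightsFrom-head (E ∷ _) (px ∷ _) = px
  All-heightsFrom-head (S ∷ _) (px ∷ _) = px

  dyckFrom : ∀ {A} k p → All (+ 0 ℤ.≤_) (heightsFrom (+ k) p) → All A (heightsFrom (+ k) p) →
             countE p + k ≡ countS p → DyckFrom A k p
  dyckFrom k [] _ _ refl = []
  dyckFrom k (E ∷ p) (_ ∷ nonneg) (_ ∷ allowed) ends =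
    up (All-heightsFrom-head p allowed′) (dyckFrom (suc k) p nonneg′ allowed′ (trans (ℕP.+-suc _ k) ends))
    where
    nonneg′  = subst (All _) (heightsFrom-suc k p) nonneg
    allowed′ = subst (All _) (heightsFrom-suc k p) allowed
  dyckFrom zero    (S ∷ p) (_ ∷ nonneg) _ _ with () ← All-heightsFrom-head p nonneg
  dyckFrom (suc k) (S ∷ p) (_ ∷ nonneg) (_ ∷ allowed) ends =
    down (dyckFrom k p nonneg allowed (ℕP.suc-injective (trans (sym (ℕP.+-suc _ k)) ends)))

  isDyck⇒dyckFrom : ∀ {A n F} → IsDyck n F → All A (heights F) → DyckFrom A 0 F
  isDyck⇒dyckFrom {F = F} (#E , #S , nonneg) allowed =
    dyckFrom 0 F nonneg allowed (trans (ℕP.+-identityʳ _) (trans #E (sym #S)))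

  height<⇒All : ∀ {b} xs → foldr ℤ._⊔_ (+ 0) xs ℤ.< b → All (ℤ._< b) xs
  height<⇒All []       _  = []
  height<⇒All (x ∷ xs) lt =
    ℤP.≤-<-trans (ℤP.i≤i⊔j x _) lt ∷ height<⇒All xs (ℤP.≤-<-trans (ℤP.i≤j⊔i x _) lt)

  All⇒height< : ∀ {b} xs → + 0 ℤ.< b → All (ℤ._< b) xs → foldr ℤ._⊔_ (+ 0) xs ℤ.< b
  All⇒height< []       0<b []            = 0<b
  All⇒height< (x ∷ xs) 0<b (x<b ∷ xs<b) with ℤP.⊔-sel x (foldr ℤ._⊔_ (+ 0) xs)
  ... | inj₁ eq = subst (ℤ._< _) (sym eq) x<b
  ... | inj₂ eq = subst (ℤ._< _) (sym eq) (All⇒height< xs 0<b xs<b)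

  avoids⇒avoidsAlong : ∀ n F R → Pointwise _<_ R (colHeights n F) →
    Avoids123 n F R → Avoids321 n F R → All Avoids (wordsAlong [] R n F)
  avoids⇒avoidsAlong n F R inBoard no123 no321 =
    subst (All Avoids) (wordsAlong-wordAt [] R n F inBoard) (All.map⁺ (All.zip (no123 , no321)))

  avoidsAlong⇒avoids : ∀ n F R → Pointwise _<_ R (colHeights n F) →
    All Avoids (wordsAlong [] R n F) → Avoids123 n F R × Avoids321 n F R
  avoidsAlong⇒avoids n F R inBoard avoids =
    All.unzip (All.map⁻ (subst (All Avoids) (sym (wordsAlong-wordAt [] R n F inBoard)) avoids))

  placement⇒wordRun : ∀ {n F R} → IsDyck n F → InR123-321 n F R →
                      ∃ λ js → WordRun ε [] R n F js × jseq n F R ≡ js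
  placement⇒wordRun {n} {F} {R} dyck ((inBoard , unique , covers) , no123 , no321) =
    labels , W , trans (jseq-wordsAlong n F R inBoard) (wordRun-labels W)
    where
    D = isDyck⇒dyckFrom dyck (All.universal (λ _ → tt) (heights F))
    perm = unique , inBoard⇒below n F inBoard , λ {r} → covers r
    run = avoiding⇒wordRun D tt perm inBoard (avoids⇒avoidsAlong n F R inBoard no123 no321)
    labels = proj₁ run
    W      = proj₂ run

  placement⇒height<5 : ∀ {n F R} → IsDyck n F → InR123-321 n F R → height F ℤ.< + 5
  placement⇒height<5 {F = F} dyck inR =
    let _ , W , _ = placement⇒wordRun dyck inR
    in All⇒height< (heights F) (+<+ (s≤s z≤n)) (shapeRun⇒heights<5 (forget W))

  placement⇒E2 : ∀ {n F R} → IsDyck n F → InR123-321 n F R →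
                 ∃ λ D → heights D ≡ jseq n F R × InE2 n F (D , F)
  placement⇒E2 dyck inR =
    let _ , W , jseq≡ = placement⇒wordRun dyck inR
        D , heights≡ , e2 = shapeRun⇒InE2 dyck (forget W)
    in D , trans heights≡ (sym jseq≡) , e2

  δ321≡⇒jseq≡ : ∀ {n F R R′} → IsDyck n F → InR123-321 n F R → InR123-321 n F R′ →
                δ321 n F R ≡ δ321 n F R′ → jseq n F R ≡ jseq n F R′
  δ321≡⇒jseq≡ {n} {F} {R} {R′} dyck inR inR′ δ≡
    with D , heights≡ , _ ← placement⇒E2 dyck inR
    with D′ , heights≡′ , _ ← placement⇒E2 dyck inR′
    with refl ← cong proj₁ (just-injective
                  (trans (sym (δ321-heights n F R heights≡)) (trans δ≡ (δ321-heights n F R′ heights≡′))))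
    = trans (sym heights≡) heights≡′

  placement-unique : ∀ {n F R R′} → IsDyck n F → InR123-321 n F R → InR123-321 n F R′ →
                     jseq n F R ≡ jseq n F R′ → R ≡ R′
  placement-unique dyck inR inR′ jseq≡
    with _ , W , labels≡ ← placement⇒wordRun dyck inR
    with _ , W′ , labels≡′ ← placement⇒wordRun dyck inR′
    with refl ← trans (sym labels≡) (trans jseq≡ labels≡′) = proj₂ (wordRun-unique W W′)

  E2⇒wordRun : ∀ {F} → DyckFrom Below5 0 F → E2Labels 0 F js →
               ∃ λ R → WordRun ε [] R (countS F) F js × IsPermutation (countS F) R
  E2⇒wordRun D e2 with shapeRun⇒wordRun (compatible⇒shapeRun D e2 (compatible-ε D e2))
  ... | []    , R , W , perm = R , W , perm
  ... | _ ∷ _ , _ , W , _    = ⊥-elim (wordRun-shape W)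

  E2⇒placement : ∀ {n F D₀} → IsDyck n F → height F ℤ.< + 5 → InE2 n F (D₀ , F) →
                 ∃ λ R → InR123-321 n F R × jseq n F R ≡ heights D₀
  E2⇒placement {F = F} dyck@(_ , refl , _) short (_ , _ , _ , e2)
    with R , W , (unique , _ , covers) ← E2⇒wordRun (isDyck⇒dyckFrom dyck (height<⇒All (heights F) short)) e2
    =
    R , ((inBoard , unique , λ _ → covers) , avoidsAlong⇒avoids _ F R inBoard (wordRun-avoids W)) ,
    trans (jseq-wordsAlong _ F R inBoard) (wordRun-labels W)
    where inBoard = wordRun-inBoard W

open import Defs
open import Data.Nat using (ℕ)
open import Data.Integer using (+_; _<_)
open import Data.List using (List)
open import Data.Maybe using (just)
open import Data.Product using (_×_; ∃; _,_)
open import Relation.Binary.PropositionalEquality using (_≡_; refl; sym)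
open import Relation.Nullary using (¬_)
open Placements

lemma6p5 : (n : ℕ) (F : Path) → IsDyck n F →
  (¬ (height F < + 5) → (R : List ℕ) → ¬ InR123-321 n F R)
  × (height F < + 5 →
      ((R : List ℕ) → InR123-321 n F R →
         ∃ λ p → δ321 n F R ≡ just p × InE2 n F p)
      × ((R R′ : List ℕ) → InR123-321 n F R → InR123-321 n F R′ →
         δ321 n F R ≡ δ321 n F R′ → R ≡ R′)
      × ((p : Path × Path) → InE2 n F p →
         ∃ λ R → InR123-321 n F R × δ321 n F R ≡ just p))
lemma6p5 n F dyck = tall , λ short → forward , injective , surjective short
  where
  tall : ¬ (height F < + 5) → (R : List ℕ) → ¬ InR123-321 n F R
  tall ¬short R inR = ¬short (placement⇒height<5 dyck inR)

  forward : (R : List ℕ) → InR123-321 n F R → ∃ λ p → δ321 n F R ≡ just p × InE2 n F p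
  forward R inR =
    let D , heights≡ , e2 = placement⇒E2 dyck inR in (D , F) , δ321-heights n F R heights≡ , e2

  injective : (R R′ : List ℕ) → InR123-321 n F R → InR123-321 n F R′ →
              δ321 n F R ≡ δ321 n F R′ → R ≡ R′
  injective R R′ inR inR′ δ≡ = placement-unique dyck inR inR′ (δ321≡⇒jseq≡ dyck inR inR′ δ≡)

  surjective : height F < + 5 → (p : Path × Path) → InE2 n F p →
               ∃ λ R → InR123-321 n F R × δ321 n F R ≡ just p
  surjective short (D₀ , _) e2@(refl , _) =
    let R , inR , jseq≡ = E2⇒placement dyck short e2 in R , inR , δ321-heights n F R (sym jseq≡)
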